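{- Let $G=(V,E)$ be a graph with $n$ vertices and $m$ edges, let $\epsilon>0$, and let $H$ be the instance constructed from $G$ as in the context. If a minimum vertex cover of $G$ has size at most $(\frac{2}{3}+\epsilon)n$, then $H$ admits an $\mathcal{A}$-perfect stable matching of total cost at most $(4+3\epsilon)mn$.
   Context: Instances: agents and programs with strict preference lists over acceptable partners ($y>_x z$: $x$ prefers $y$ to $z$), each program $p$ with a non-negative integer cost $c(p)$ and no quota. A matching assigns each agent to at most one acceptable program (programs can take any number of agents); $M(a)$, $M(p)$ denote partners. A pair $(a,p)$ not in $M$ with $p$ acceptable to $a$ blocks $M$ if $p>_a M(a)$ (any acceptable program beats being unmatched) and some $a'\in M(p)$ has $a>_p a'$; $M$ is stable if there is no blocking pair, $\mathcal{A}$-perfect if all agents are matched, and its total cost is $\sum_p|M(p)|c(p)$. Construction of $H$ from $G$ with vertices $u_1,\dots,u_n$ and edges $e_1,\dots,e_m$: for each vertex $u_i$ there are $m$ vertex-agents $a_i^1,\dots,a_i^m$ and two programs $p_i$ (cost $3$) and $p_i'$ (cost $2n$); for each edge $e_j$ there is an edge-agent $a_j'$; there is one further program $p$ (cost $0$). Each $a_i^t$ has preference list $p_i, p_i', p$. Each $a_j'$ has preference list consisting of the two programs $p'_{j1},p'_{j2}$ for the endpoints $u_{j1},u_{j2}$ of $e_j$, in an arbitrary order. $p_i$ has list $a_i^1,\dots,a_i^m$; $p_i'$ has list $a_i^1,\dots,a_i^m$ followed by the edge-agents of the edges incident to $u_i$ (in arbitrary order); $p$ has all $mn$ vertex-agents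 in an arbitrary fixed order.
   Formalization: The parameter ε ranges over the positive rationals. -}

module Defs where

open import Data.Nat using (ℕ; zero; suc; _+_; _*_)
open import Data.Fin using (Fin)
open import Data.Fin.Properties using () renaming (_≟_ to _≟F_)
open import Data.Fin.Subset using (Subset; _∈_; ∣_∣)
open import Data.List using (List; []; _∷_; _++_; map; filter; length; allFin; cartesianProduct)
open import Data.Nat.ListAction using (sum)
open import Data.List.Membership.Propositional using () renaming (_∈_ to _∈ₗ_)
open import Data.Maybe using (Maybe; just; nothing)
open import Data.Maybe.Properties using (≡-dec)
open import Data.Product using (Σ; ∃; _×_; _,_; proj₁; proj₂; uncurry)
open import Data.Sum using (_⊎_)
open import Relation.Binary.PropositionalEquality using (_≡_; _≢_)
open import Relation.Binary.Definitions using (DecidableEquality)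
open import Relation.Nullary using (¬_; yes; no)
open import Relation.Nullary.Decidable using (_⊎-dec_)

record SimpleGraph (n m : ℕ) : Set where
  field
    edge     : Fin m → Fin n × Fin n
    loopless : ∀ j → proj₁ (edge j) ≢ proj₂ (edge j)
    noMulti  : ∀ j k → j ≢ k →
               edge j ≢ edge k × edge j ≢ (proj₂ (edge k) , proj₁ (edge k))
open SimpleGraph public

IsVertexCover : ∀ {n m} → SimpleGraph n m → Subset n → Set
IsVertexCover G C = ∀ j → proj₁ (edge G j) ∈ C ⊎ proj₂ (edge G j) ∈ C

IsMinVertexCover : ∀ {n m} → SimpleGraph n m → Subset n → Set
IsMinVertexCover G C =
  IsVertexCover G C × (∀ C′ → IsVertexCover G C′ → ∣ C ∣ Data.Nat.≤ ∣ C′ ∣)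

incident? : ∀ {n m} (G : SimpleGraph n m) (i : Fin n) (j : Fin m) → _
incident? G i j = (proj₁ (edge G j) ≟F i) ⊎-dec (proj₂ (edge G j) ≟F i)

record Instance : Set₁ where
  field
    Agent    : Set
    Prog     : Set
    agents   : List Agent
    programs : List Prog
    _≟P_     : DecidableEquality Prog
    prefA    : Agent → List Prog   -- preference list of an agent (best first)
    prefP    : Prog → List Agent   -- preference list of a program (best first)
    cost     : Prog → ℕ
open Instance public

data Before {A : Set} : List A → A → A → Set where
  here  : ∀ {y z xs} → z ∈ₗ xs → Before (y ∷ xs) y z
  there : ∀ {w y z xs} → Before xs y z → Before (w ∷ xs) y z

module _ (I : Instance) where

  Acceptable : Agent I → Prog I → Set
  Acceptable a p = (p ∈ₗ prefA I a) × (a ∈ₗ prefP I p)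

  record Matching : Set where
    field
      assign     : Agent I → Maybe (Prog I)
      acceptable : ∀ a p → assign a ≡ just p → Acceptable a p
  open Matching public

  PrefersToCurrent : Matching → Agent I → Prog I → Set
  PrefersToCurrent M a p =
    (assign M a ≡ nothing) ⊎ (∃ λ q → assign M a ≡ just q × Before (prefA I a) p q)

  BlockingPair : Matching → Agent I → Prog I → Set
  BlockingPair M a p =
    (assign M a ≢ just p) × (p ∈ₗ prefA I a) × PrefersToCurrent M a p ×
    (∃ λ a′ → assign M a′ ≡ just p × Before (prefP I p) a a′)

  Stable : Matching → Set
  Stable M = ∀ a p → ¬ BlockingPair M a p

  APerfect : Matching → Set
  APerfect M = ∀ a → ∃ λ p → assign M a ≡ just p

  load : Matching → Prog I → ℕ
  load M p = length (filter (λ a → ≡-dec (_≟P_ I) (assign M a) (just p)) (agents I))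

  totalCost : Matching → ℕ
  totalCost M = sum (map (λ p → load M p * cost I p) (programs I))

data HAgent (n m : ℕ) : Set where
  vAgent : Fin n → Fin m → HAgent n m
  eAgent : Fin m → HAgent n m

data HProg (n : ℕ) : Set where
  pv  : Fin n → HProg n
  pv′ : Fin n → HProg n
  p₀  : HProg n

_≟H_ : ∀ {n} → DecidableEquality (HProg n)
pv i ≟H pv k with i ≟F k
... | yes Relation.Binary.PropositionalEquality.refl = yes Relation.Binary.PropositionalEquality.refl
... | no ne = no λ { Relation.Binary.PropositionalEquality.refl → ne Relation.Binary.PropositionalEquality.refl }
pv′ i ≟H pv′ k with i ≟F k
... | yes Relation.Binary.PropositionalEquality.refl = yes Relation.Binary.PropositionalEquality.refl
... | no ne = no λ { Relation.Binary.PropositionalEquality.refl → ne Relation.Binary.PropositionalEquality.refl }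
p₀ ≟H p₀ = yes Relation.Binary.PropositionalEquality.refl
pv _ ≟H pv′ _ = no λ ()
pv _ ≟H p₀ = no λ ()
pv′ _ ≟H pv _ = no λ ()
pv′ _ ≟H p₀ = no λ ()
p₀ ≟H pv _ = no λ ()
p₀ ≟H pv′ _ = no λ ()

-- The "arbitrary orders" are parameters:
--   σ i : the order of the edge-agents in p'_i's list (a listing of the edges
--         incident to u_i, see ValidOrders),
--   τ   : the order of the vertex-agents in p's list (a listing of all (i,t)).
H : ∀ {n m} → SimpleGraph n m → (Fin n → List (Fin m)) → List (Fin n × Fin m) → Instance
H {n} {m} G σ τ = record
  { Agent    = HAgent n m
  ; Prog     = HProg n
  ; agents   = map (uncurry vAgent) (cartesianProduct (allFin n) (allFin m))
               ++ map eAgent (allFin m)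
  ; programs = map pv (allFin n) ++ map pv′ (allFin n) ++ (p₀ ∷ [])
  ; _≟P_     = _≟H_
  ; prefA    = prefA′
  ; prefP    = prefP′
  ; cost     = cost′
  }
  where
  prefA′ : HAgent n m → List (HProg n)
  prefA′ (vAgent i t) = pv i ∷ pv′ i ∷ p₀ ∷ []
  prefA′ (eAgent j)   = pv′ (proj₁ (edge G j)) ∷ pv′ (proj₂ (edge G j)) ∷ []
  prefP′ : HProg n → List (HAgent n m)
  prefP′ (pv i)  = map (vAgent i) (allFin m)
  prefP′ (pv′ i) = map (vAgent i) (allFin m) ++ map eAgent (σ i)
  prefP′ p₀      = map (uncurry vAgent) τ
  cost′ : HProg n → ℕ
  cost′ (pv _)  = 3
  cost′ (pv′ _) = 2 * n
  cost′ p₀      = 0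

-- Let C be a vertex cover with |C| ≤ (2/3 + ε)n. Send a_i^t to p_i when u_i ∈ C and to p
-- otherwise, and send each edge-agent to p'_i for an endpoint u_i ∈ C (its first choice
-- if possible). Only programs of covered vertices (and p) are occupied, so every agent
-- either holds its first choice or prefers only empty programs: the matching is stable and
-- A-perfect. Its cost is 3m|C| + 2nm ≤ 3m(2/3 + ε)n + 2nm = (4 + 3ε)mn.
module Submission where

open import Defs
open import Data.Nat using (ℕ)
open import Data.Fin using (Fin)
open import Data.Fin.Subset using (Subset; ∣_∣)
open import Data.List using (List; filter; allFin; cartesianProduct)
open import Data.List.Relation.Binary.Permutation.Propositional using (_↭_)
open import Data.Product using (Σ; ∃; _×_)
open import Data.Integer using (+_)
open import Data.Rational using (ℚ; _/_; _+_; _*_; _≤_; _<_; 0ℚ)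

open import Data.Bool using (true; false; if_then_else_)
open import Data.Bool.Properties using (if-float)
open import Data.Fin.Subset using (_∈_; _∉_; inside; outside)
open import Data.Fin.Subset.Properties using (_∈?_)
open import Data.Vec using ([]; _∷_)
open import Data.List using ([]; _∷_; _++_; map; length; tabulate)
open import Data.List.Properties using (map-++; map-∘; map-cong; map-tabulate; length-tabulate; tabulate-cong)
open import Data.List.Membership.Propositional using () renaming (_∈_ to _∈ₗ_; _∉_ to _∉ₗ_)
open import Data.List.Membership.Propositional.Properties
  using (∈-map⁺; ∈-map⁻; ∈-++⁺ˡ; ∈-++⁺ʳ; ∈-++⁻; ∈-allFin; ∈-filter⁺; ∈-cartesianProduct⁺)
open import Data.List.Relation.Binary.Permutation.Propositional using (↭-sym)
open import Data.List.Relation.Binary.Permutation.Propositional.Properties using (∈-resp-↭)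
open import Data.List.Relation.Unary.All as All using (All; []; _∷_)
open import Data.List.Relation.Unary.Any using (here; there)
open import Data.List.Relation.Unary.Unique.Propositional using (Unique; []; _∷_)
open import Data.List.Relation.Unary.Unique.Propositional.Properties using (map⁺; ++⁺; allFin⁺)
open import Data.Maybe using (just; nothing)
open import Data.Maybe.Properties using (≡-dec; just-injective)
open import Data.Nat.ListAction using (sum)
open import Data.Nat.ListAction.Properties using (sum-++)
open import Data.Product using (_,_; proj₁; proj₂; uncurry)
open import Data.Sum using (_⊎_; inj₁; inj₂)
open import Function using (_∘_; const)
open import Relation.Binary.PropositionalEquality
open import Relation.Nullary using (¬_; Dec; yes; no; does; contradiction)
open import Relation.Nullary.Decidable using (dec-true; dec-false)
open import Relation.Unary using (Decidable)

import Data.Integer as ℤ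
import Data.Integer.Properties as ℤ
open import Data.Rational using (toℚᵘ; NonNegative)
open import Data.Rational.Properties
  using (toℚᵘ-injective; toℚᵘ-fromℚᵘ; toℚᵘ-homo-+; toℚᵘ-homo-*; normalize-nonNeg; nonNeg*nonNeg⇒nonNeg;
         +-monoˡ-≤; *-monoˡ-≤-nonNeg; module ≤-Reasoning; +-*-commutativeRing)
open import Data.Rational.Unnormalised as ℚᵘ using (mkℚᵘ; *≡*) renaming (_≃_ to _≃ᵘ_)
import Data.Rational.Unnormalised.Properties as ℚᵘ
open import Data.Nat.Tactic.RingSolver using () renaming (solve-∀ to ℕ-solve-∀)
open import Tactic.RingSolver using () renaming (solve-∀ to ℚ-solve-∀)
open import Tactic.RingSolver.Core.AlmostCommutativeRing using (AlmostCommutativeRing; fromCommutativeRing)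

import Data.Nat as ℕ
import Data.Nat.Properties as ℕ
open import Algebra.Properties.CommutativeSemigroup ℕ.+-commutativeSemigroup using (interchange)

module _ {A : Set} where

  sum-map-+ : (f g : A → ℕ) (xs : List A) →
    sum (map (λ x → f x ℕ.+ g x) xs) ≡ sum (map f xs) ℕ.+ sum (map g xs)
  sum-map-+ f g [] = refl
  sum-map-+ f g (x ∷ xs) =
    trans (cong (f x ℕ.+ g x ℕ.+_) (sum-map-+ f g xs)) (interchange (f x) (g x) _ _)

  sum-map-const : (k : ℕ) (xs : List A) → sum (map (const k) xs) ≡ length xs ℕ.* k
  sum-map-const k [] = refl
  sum-map-const k (x ∷ xs) = cong (k ℕ.+_) (sum-map-const k xs)

  length-filter-* : {P : A → Set} (P? : Decidable P) (k : ℕ) (xs : List A) →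
    length (filter P? xs) ℕ.* k ≡ sum (map (λ x → if does (P? x) then k else 0) xs)
  length-filter-* P? k [] = refl
  length-filter-* P? k (x ∷ xs) with does (P? x)
  ... | true  = cong (k ℕ.+_) (length-filter-* P? k xs)
  ... | false = length-filter-* P? k xs

  module _ {P : A → Set} (P? : Decidable P) (c : A → ℕ) where

    sum-select : List A → ℕ
    sum-select = sum ∘ map (λ x → if does (P? x) then c x else 0)

    sum-select-none : ∀ {xs} → All (¬_ ∘ P) xs → sum-select xs ≡ 0
    sum-select-none [] = refl
    sum-select-none {x ∷ _} (¬Px ∷ ¬Pxs) rewrite dec-false (P? x) ¬Px = sum-select-none ¬Pxs

    sum-select-unique : ∀ {x xs} → Unique xs → x ∈ₗ xs → P x → (∀ {y} → P y → y ≡ x) →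
      sum-select xs ≡ c x
    sum-select-unique {x} (x≢xs ∷ _) (here refl) Px only rewrite dec-true (P? x) Px =
      trans (cong (c x ℕ.+_) (sum-select-none (All.map (λ x≢y Py → x≢y (sym (only Py))) x≢xs)))
            (ℕ.+-identityʳ (c x))
    sum-select-unique {x} {y ∷ _} (y≢xs ∷ xs-unique) (there x∈xs) Px only with P? y
    ... | yes Py = contradiction (only Py) (All.lookup y≢xs x∈xs)
    ... | no _   = sum-select-unique xs-unique x∈xs Px only

module _ {A B : Set} where

  sum-map-comm : (g : A → B → ℕ) (xs : List A) (ys : List B) →
    sum (map (λ y → sum (map (λ x → g x y) xs)) ys) ≡ sum (map (λ x → sum (map (g x) ys)) xs)
  sum-map-comm g xs [] = sym (trans (sum-map-const 0 xs) (ℕ.*-zeroʳ (length xs)))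
  sum-map-comm g xs (y ∷ ys) =
    trans (cong (sum (map (λ x → g x y) xs) ℕ.+_) (sum-map-comm g xs ys))
          (sym (sum-map-+ (λ x → g x y) (λ x → sum (map (g x) ys)) xs))

  sum-map-cartesianProduct-proj₁ : (f : A → ℕ) (xs : List A) (ys : List B) →
    sum (map (f ∘ proj₁) (cartesianProduct xs ys)) ≡ sum (map f xs) ℕ.* length ys
  sum-map-cartesianProduct-proj₁ f [] ys = refl
  sum-map-cartesianProduct-proj₁ f (x ∷ xs) ys = begin
    sum (map (f ∘ proj₁) (map (x ,_) ys ++ cartesianProduct xs ys))
      ≡⟨ cong sum (map-++ (f ∘ proj₁) (map (x ,_) ys) _) ⟩
    sum (map (f ∘ proj₁) (map (x ,_) ys) ++ map (f ∘ proj₁) (cartesianProduct xs ys))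
      ≡⟨ sum-++ (map (f ∘ proj₁) (map (x ,_) ys)) _ ⟩
    sum (map (f ∘ proj₁) (map (x ,_) ys)) ℕ.+ sum (map (f ∘ proj₁) (cartesianProduct xs ys))
      ≡⟨ cong₂ ℕ._+_ (trans (cong sum (sym (map-∘ ys))) (sum-map-const (f x) ys))
                     (sum-map-cartesianProduct-proj₁ f xs ys) ⟩
    length ys ℕ.* f x ℕ.+ sum (map f xs) ℕ.* length ys
      ≡⟨ cong (ℕ._+ sum (map f xs) ℕ.* length ys) (ℕ.*-comm (length ys) (f x)) ⟩
    f x ℕ.* length ys ℕ.+ sum (map f xs) ℕ.* length ys
      ≡⟨ ℕ.*-distribʳ-+ (length ys) (f x) (sum (map f xs)) ⟨
    (f x ℕ.+ sum (map f xs)) ℕ.* length ys ∎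
    where open ≡-Reasoning

length-allFin : ∀ n → length (allFin n) ≡ n
length-allFin n = length-tabulate (λ i → i)

sum-tabulate-if-∈ : ∀ {n} (C : Subset n) (k : ℕ) →
  sum (tabulate (λ i → if does (i ∈? C) then k else 0)) ≡ ∣ C ∣ ℕ.* k
sum-tabulate-if-∈ []            k = refl
sum-tabulate-if-∈ (inside ∷ C)  k = cong (k ℕ.+_) (sum-tabulate-if-∈ C k)
sum-tabulate-if-∈ (outside ∷ C) k = sum-tabulate-if-∈ C k

module _ {A : Set} {x y : A} where

  Before-∈ʳ : ∀ {xs} → Before xs x y → y ∈ₗ xs
  Before-∈ʳ (here y∈xs) = there y∈xs
  Before-∈ʳ (there x<y) = there (Before-∈ʳ x<y)

  Before-head : ∀ {xs} → Before (y ∷ xs) x y → y ∈ₗ xs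
  Before-head (here y∈xs) = y∈xs
  Before-head (there x<y) = Before-∈ʳ x<y

module _ (I : Instance) (M : Matching I) where

  top-choice-¬blocking : ∀ {a p ps q} → prefA I a ≡ p ∷ ps → p ∉ₗ ps → assign M a ≡ just p →
    ¬ BlockingPair I M a q
  top-choice-¬blocking _ _ a↦p (_ , _ , inj₁ a↦nothing , _) with trans (sym a↦p) a↦nothing
  ... | ()
  top-choice-¬blocking {p = p} {q = q} prefs p∉ps a↦p (_ , _ , inj₂ (p′ , a↦p′ , q<p′) , _)
    with just-injective (trans (sym a↦p) a↦p′)
  ... | refl = p∉ps (Before-head (subst (λ xs → Before xs q p) prefs q<p′))

  totalCost-perfect : (f : Agent I → Prog I) → (∀ a → assign M a ≡ just (f a)) →
    Unique (programs I) → (∀ p → p ∈ₗ programs I) →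
    totalCost I M ≡ sum (map (cost I ∘ f) (agents I))
  totalCost-perfect f M≡f programs-unique ∈-programs = begin
    totalCost I M
      ≡⟨ cong sum (map-cong (λ p → length-filter-* (λ a → assignedTo a p) (cost I p) (agents I)) (programs I)) ⟩
    sum (map (λ p → sum (map (λ a → if does (assignedTo a p) then cost I p else 0) (agents I))) (programs I))
      ≡⟨ sum-map-comm (λ a p → if does (assignedTo a p) then cost I p else 0) (agents I) (programs I) ⟩
    sum (map (λ a → sum-select (assignedTo a) (cost I) (programs I)) (agents I))
      ≡⟨ cong sum (map-cong (λ a → sum-select-unique (assignedTo a) (cost I) programs-unique
                                     (∈-programs (f a)) (M≡f a) (only a)) (agents I)) ⟩
    sum (map (cost I ∘ f) (agents I)) ∎
    where
    open ≡-Reasoning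
    assignedTo : ∀ a p → Dec (assign M a ≡ just p)
    assignedTo a p = ≡-dec (_≟P_ I) (assign M a) (just p)
    only : ∀ a {p} → assign M a ≡ just p → p ≡ f a
    only a a↦p = just-injective (trans (sym a↦p) (M≡f a))

pv-injective : ∀ {n} {i k : Fin n} → pv i ≡ pv k → i ≡ k
pv-injective refl = refl

pv′-injective : ∀ {n} {i k : Fin n} → pv′ i ≡ pv′ k → i ≡ k
pv′-injective refl = refl

module Construction {n m : ℕ} (G : SimpleGraph n m)
  (σ : Fin n → List (Fin m)) (σ-incident : ∀ i → σ i ↭ filter (incident? G i) (allFin m))
  (τ : List (Fin n × Fin m)) (τ-all : τ ↭ cartesianProduct (allFin n) (allFin m)) where

  I : Instance
  I = H G σ τ

  end₁ end₂ : Fin m → Fin n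
  end₁ j = proj₁ (edge G j)
  end₂ j = proj₂ (edge G j)

  vertexAgents edgeAgents : List (HAgent n m)
  vertexAgents = map (uncurry vAgent) (cartesianProduct (allFin n) (allFin m))
  edgeAgents   = map eAgent (allFin m)

  ∈-programs : ∀ p → p ∈ₗ programs I
  ∈-programs (pv i)  = ∈-++⁺ˡ (∈-map⁺ pv (∈-allFin i))
  ∈-programs (pv′ i) = ∈-++⁺ʳ (map pv (allFin n)) (∈-++⁺ˡ (∈-map⁺ pv′ (∈-allFin i)))
  ∈-programs p₀      = ∈-++⁺ʳ (map pv (allFin n)) (∈-++⁺ʳ (map pv′ (allFin n)) (here refl))

  programs-unique : Unique (programs I)
  programs-unique =
    ++⁺ (map⁺ pv-injective (allFin⁺ n))
        (++⁺ (map⁺ pv′-injective (allFin⁺ n)) ([] ∷ []) pv′-p₀-disjoint)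
        pv-rest-disjoint
    where
    pv′-p₀-disjoint : ∀ {p} → ¬ (p ∈ₗ map pv′ (allFin n) × p ∈ₗ p₀ ∷ [])
    pv′-p₀-disjoint (p∈ , here refl) with ∈-map⁻ pv′ p∈
    ... | _ , _ , ()
    pv-rest-disjoint : ∀ {p} → ¬ (p ∈ₗ map pv (allFin n) × p ∈ₗ map pv′ (allFin n) ++ p₀ ∷ [])
    pv-rest-disjoint (p∈ , p∈′) with ∈-map⁻ pv p∈ | ∈-++⁻ (map pv′ (allFin n)) p∈′
    ... | _ , _ , refl | inj₁ p∈pv′ with ∈-map⁻ pv′ p∈pv′
    ...   | _ , _ , ()
    pv-rest-disjoint (p∈ , p∈′) | _ , _ , refl | inj₂ (here ())

  vAgent-∈-p₀ : ∀ i t → vAgent i t ∈ₗ prefP I p₀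
  vAgent-∈-p₀ i t = ∈-map⁺ (uncurry vAgent)
    (∈-resp-↭ (↭-sym τ-all) (∈-cartesianProduct⁺ (∈-allFin i) (∈-allFin t)))

  eAgent-∈-pv′ : ∀ {j k} → end₁ j ≡ k ⊎ end₂ j ≡ k → eAgent j ∈ₗ prefP I (pv′ k)
  eAgent-∈-pv′ {j} {k} j∼k = ∈-++⁺ʳ (map (vAgent k) (allFin m)) (∈-map⁺ eAgent
    (∈-resp-↭ (↭-sym (σ-incident k)) (∈-filter⁺ (incident? G k) (∈-allFin j) j∼k)))

  module CoverMatching (C : Subset n) (C-cover : IsVertexCover G C) where

    vertexProgram : Fin n → HProg n
    vertexProgram i = if does (i ∈? C) then pv i else p₀

    vertexProgram-∈ : ∀ {i} → i ∈ C → vertexProgram i ≡ pv i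
    vertexProgram-∈ {i} i∈C = cong (if_then pv i else p₀) (dec-true (i ∈? C) i∈C)

    vertexProgram-∉ : ∀ {i} → i ∉ C → vertexProgram i ≡ p₀
    vertexProgram-∉ {i} i∉C = cong (if_then pv i else p₀) (dec-false (i ∈? C) i∉C)

    coveringEndpoint : Fin m → Fin n
    coveringEndpoint j = if does (end₁ j ∈? C) then end₁ j else end₂ j

    coveringEndpoint-∈₁ : ∀ {j} → end₁ j ∈ C → coveringEndpoint j ≡ end₁ j
    coveringEndpoint-∈₁ {j} e₁∈C = cong (if_then end₁ j else end₂ j) (dec-true (end₁ j ∈? C) e₁∈C)

    coveringEndpoint-∉₁ : ∀ {j} → end₁ j ∉ C → coveringEndpoint j ≡ end₂ j
    coveringEndpoint-∉₁ {j} e₁∉C = cong (if_then end₁ j else end₂ j) (dec-false (end₁ j ∈? C) e₁∉C)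

    coveringEndpoint-∈ : ∀ j → coveringEndpoint j ∈ C
    coveringEndpoint-∈ j with end₁ j ∈? C | C-cover j
    ... | yes e₁∈C | _         = e₁∈C
    ... | no e₁∉C  | inj₁ e₁∈C = contradiction e₁∈C e₁∉C
    ... | no _     | inj₂ e₂∈C = e₂∈C

    match : HAgent n m → HProg n
    match (vAgent i _) = vertexProgram i
    match (eAgent j)   = pv′ (coveringEndpoint j)

    match-acceptable : ∀ a → Acceptable I a (match a)
    match-acceptable (vAgent i t) with i ∈? C
    ... | yes _ = here refl , ∈-map⁺ (vAgent i) (∈-allFin t)
    ... | no _  = there (there (here refl)) , vAgent-∈-p₀ i t
    match-acceptable (eAgent j) with end₁ j ∈? C
    ... | yes _ = here refl , eAgent-∈-pv′ (inj₁ refl)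
    ... | no _  = there (here refl) , eAgent-∈-pv′ (inj₂ refl)

    M : Matching I
    M = record { assign = just ∘ match ; acceptable = λ { a _ refl → match-acceptable a } }

    pv-occupied⇒∈ : ∀ a {k} → match a ≡ pv k → k ∈ C
    pv-occupied⇒∈ (vAgent i _) a↦k with i ∈? C
    pv-occupied⇒∈ (vAgent i _) refl | yes i∈C = i∈C
    pv-occupied⇒∈ (eAgent _) ()

    pv′-occupied⇒∈ : ∀ a {k} → match a ≡ pv′ k → k ∈ C
    pv′-occupied⇒∈ (vAgent i _) a↦k with i ∈? C
    pv′-occupied⇒∈ (vAgent i _) () | yes _
    pv′-occupied⇒∈ (vAgent i _) () | no _
    pv′-occupied⇒∈ (eAgent j) refl = coveringEndpoint-∈ j

    vAgent-stable : ∀ {i} t q → Dec (i ∈ C) → ¬ BlockingPair I M (vAgent i t) q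
    vAgent-stable t q (yes i∈C) = top-choice-¬blocking I M refl
      (λ { (here ()) ; (there (here ())) ; (there (there ())) }) (cong just (vertexProgram-∈ i∈C))
    vAgent-stable t q (no i∉C) = λ
      { (_ , here refl , _ , a′ , a′↦q , _) → i∉C (pv-occupied⇒∈ a′ (just-injective a′↦q))
      ; (_ , there (here refl) , _ , a′ , a′↦q , _) → i∉C (pv′-occupied⇒∈ a′ (just-injective a′↦q))
      ; (q≢ , there (there (here refl)) , _) → q≢ (cong just (vertexProgram-∉ i∉C))
      ; (_ , there (there (there ())) , _) }

    eAgent-stable : ∀ {j} q → Dec (end₁ j ∈ C) → ¬ BlockingPair I M (eAgent j) q
    eAgent-stable {j} q (yes e₁∈C) = top-choice-¬blocking I M refl
      (λ { (here e₁≡e₂) → loopless G j (pv′-injective e₁≡e₂) ; (there ()) })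
      (cong (just ∘ pv′) (coveringEndpoint-∈₁ e₁∈C))
    eAgent-stable q (no e₁∉C) = λ
      { (_ , here refl , _ , a′ , a′↦q , _) → e₁∉C (pv′-occupied⇒∈ a′ (just-injective a′↦q))
      ; (q≢ , there (here refl) , _) → q≢ (cong (just ∘ pv′) (coveringEndpoint-∉₁ e₁∉C))
      ; (_ , there (there ()) , _) }

    match-stable : Stable I M
    match-stable (vAgent i t) q = vAgent-stable t q (i ∈? C)
    match-stable (eAgent j)   q = eAgent-stable q (end₁ j ∈? C)

    match-perfect : APerfect I M
    match-perfect a = match a , refl

    vertexAgents-cost : sum (map (cost I ∘ match) vertexAgents) ≡ ∣ C ∣ ℕ.* 3 ℕ.* m
    vertexAgents-cost = begin
      sum (map (cost I ∘ match) vertexAgents)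
        ≡⟨ cong sum (map-∘ (cartesianProduct (allFin n) (allFin m))) ⟨
      sum (map (cost I ∘ vertexProgram ∘ proj₁) (cartesianProduct (allFin n) (allFin m)))
        ≡⟨ sum-map-cartesianProduct-proj₁ (cost I ∘ vertexProgram) (allFin n) (allFin m) ⟩
      sum (map (cost I ∘ vertexProgram) (allFin n)) ℕ.* length (allFin m)
        ≡⟨ cong (ℕ._* length (allFin m)) (cong sum (map-tabulate (λ i → i) (cost I ∘ vertexProgram))) ⟩
      sum (tabulate (cost I ∘ vertexProgram)) ℕ.* length (allFin m)
        ≡⟨ cong₂ ℕ._*_ (cong sum (tabulate-cong (λ i → if-float (cost I) (does (i ∈? C)))))
                       (length-allFin m) ⟩
      sum (tabulate (λ i → if does (i ∈? C) then 3 else 0)) ℕ.* m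
        ≡⟨ cong (ℕ._* m) (sum-tabulate-if-∈ C 3) ⟩
      ∣ C ∣ ℕ.* 3 ℕ.* m ∎
      where open ≡-Reasoning

    edgeAgents-cost : sum (map (cost I ∘ match) edgeAgents) ≡ m ℕ.* (2 ℕ.* n)
    edgeAgents-cost = begin
      sum (map (cost I ∘ match) edgeAgents)  ≡⟨ cong sum (map-∘ (allFin m)) ⟨
      sum (map (const (2 ℕ.* n)) (allFin m)) ≡⟨ sum-map-const (2 ℕ.* n) (allFin m) ⟩
      length (allFin m) ℕ.* (2 ℕ.* n)        ≡⟨ cong (ℕ._* (2 ℕ.* n)) (length-allFin m) ⟩
      m ℕ.* (2 ℕ.* n)                        ∎
      where open ≡-Reasoning

    match-totalCost : totalCost I M ≡ ∣ C ∣ ℕ.* 3 ℕ.* m ℕ.+ m ℕ.* (2 ℕ.* n)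
    match-totalCost = begin
      totalCost I M
        ≡⟨ totalCost-perfect I M match (λ _ → refl) programs-unique ∈-programs ⟩
      sum (map (cost I ∘ match) (vertexAgents ++ edgeAgents))
        ≡⟨ cong sum (map-++ (cost I ∘ match) vertexAgents edgeAgents) ⟩
      sum (map (cost I ∘ match) vertexAgents ++ map (cost I ∘ match) edgeAgents)
        ≡⟨ sum-++ (map (cost I ∘ match) vertexAgents) _ ⟩
      sum (map (cost I ∘ match) vertexAgents) ℕ.+ sum (map (cost I ∘ match) edgeAgents)
        ≡⟨ cong₂ ℕ._+_ vertexAgents-cost edgeAgents-cost ⟩
      ∣ C ∣ ℕ.* 3 ℕ.* m ℕ.+ m ℕ.* (2 ℕ.* n) ∎
      where open ≡-Reasoning

ℚ-ring : AlmostCommutativeRing _ _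
ℚ-ring = fromCommutativeRing +-*-commutativeRing (λ _ → nothing)

fromℕ : ℕ → ℚ
fromℕ k = + k / 1

toℚᵘ-fromℕ : ∀ k → toℚᵘ (fromℕ k) ≃ᵘ mkℚᵘ (+ k) 0
toℚᵘ-fromℕ k = toℚᵘ-fromℚᵘ (mkℚᵘ (+ k) 0)

fromℕ-+ : ∀ a b → fromℕ (a ℕ.+ b) ≡ fromℕ a + fromℕ b
fromℕ-+ a b = toℚᵘ-injective (begin
  toℚᵘ (fromℕ (a ℕ.+ b))             ≈⟨ toℚᵘ-fromℕ (a ℕ.+ b) ⟩
  mkℚᵘ (+ (a ℕ.+ b)) 0               ≈⟨ *≡* (trans (ℤ.*-identityʳ _) (sym (trans (ℤ.*-identityʳ _)
                                          (cong₂ ℤ._+_ (ℤ.*-identityʳ (+ a)) (ℤ.*-identityʳ (+ b)))))) ⟩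
  mkℚᵘ (+ a) 0 ℚᵘ.+ mkℚᵘ (+ b) 0     ≈⟨ ℚᵘ.+-cong (toℚᵘ-fromℕ a) (toℚᵘ-fromℕ b) ⟨
  toℚᵘ (fromℕ a) ℚᵘ.+ toℚᵘ (fromℕ b) ≈⟨ toℚᵘ-homo-+ (fromℕ a) (fromℕ b) ⟨
  toℚᵘ (fromℕ a + fromℕ b)           ∎)
  where open ℚᵘ.≃-Reasoning

fromℕ-* : ∀ a b → fromℕ (a ℕ.* b) ≡ fromℕ a * fromℕ b
fromℕ-* a b = toℚᵘ-injective (begin
  toℚᵘ (fromℕ (a ℕ.* b))             ≈⟨ toℚᵘ-fromℕ (a ℕ.* b) ⟩
  mkℚᵘ (+ (a ℕ.* b)) 0               ≈⟨ *≡* (trans (ℤ.*-identityʳ _) (sym (trans (ℤ.*-identityʳ _)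
                                          (sym (ℤ.pos-* a b))))) ⟩
  mkℚᵘ (+ a) 0 ℚᵘ.* mkℚᵘ (+ b) 0     ≈⟨ ℚᵘ.*-cong (toℚᵘ-fromℕ a) (toℚᵘ-fromℕ b) ⟨
  toℚᵘ (fromℕ a) ℚᵘ.* toℚᵘ (fromℕ b) ≈⟨ toℚᵘ-homo-* (fromℕ a) (fromℕ b) ⟨
  toℚᵘ (fromℕ a * fromℕ b)           ∎)
  where open ℚᵘ.≃-Reasoning

fromℕ-nonNeg : ∀ k → NonNegative (fromℕ k)
fromℕ-nonNeg k = normalize-nonNeg k 1

cost-bound : ∀ m n c (ε : ℚ) → fromℕ c ≤ ((+ 2) / 3 + ε) * fromℕ n →
  fromℕ (c ℕ.* 3 ℕ.* m ℕ.+ m ℕ.* (2 ℕ.* n)) ≤ ((+ 4) / 1 + (+ 3) / 1 * ε) * fromℕ m * fromℕ n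
cost-bound m n c ε c≤ = begin
  fromℕ (c ℕ.* 3 ℕ.* m ℕ.+ m ℕ.* (2 ℕ.* n))
    ≡⟨ cong fromℕ (ℕ-rearrange c m n) ⟩
  fromℕ (3 ℕ.* m ℕ.* c ℕ.+ 2 ℕ.* n ℕ.* m)
    ≡⟨ fromℕ-+ (3 ℕ.* m ℕ.* c) (2 ℕ.* n ℕ.* m) ⟩
  fromℕ (3 ℕ.* m ℕ.* c) + fromℕ (2 ℕ.* n ℕ.* m)
    ≡⟨ cong₂ _+_ (trans (fromℕ-* (3 ℕ.* m) c) (cong (_* fromℕ c) (fromℕ-* 3 m)))
                 (trans (fromℕ-* (2 ℕ.* n) m) (cong (_* fromℕ m) (fromℕ-* 2 n))) ⟩
  fromℕ 3 * fromℕ m * fromℕ c + fromℕ 2 * fromℕ n * fromℕ m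
    ≤⟨ +-monoˡ-≤ (fromℕ 2 * fromℕ n * fromℕ m) (*-monoˡ-≤-nonNeg (fromℕ 3 * fromℕ m) {{3m-nonNeg}} c≤) ⟩
  fromℕ 3 * fromℕ m * (((+ 2) / 3 + ε) * fromℕ n) + fromℕ 2 * fromℕ n * fromℕ m
    ≡⟨ ℚ-rearrange (fromℕ 3) ((+ 2) / 3) ε (fromℕ m) (fromℕ n) (fromℕ 2) ⟩
  (fromℕ 3 * ((+ 2) / 3) + fromℕ 2 + fromℕ 3 * ε) * fromℕ m * fromℕ n
    ≡⟨⟩  -- closed rational arithmetic: 3 · 2/3 + 2 and 3 evaluate to 4/1 and 3/1
  ((+ 4) / 1 + (+ 3) / 1 * ε) * fromℕ m * fromℕ n ∎
  where
  open ≤-Reasoning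
  3m-nonNeg : NonNegative (fromℕ 3 * fromℕ m)
  3m-nonNeg = nonNeg*nonNeg⇒nonNeg (fromℕ 3) {{fromℕ-nonNeg 3}} (fromℕ m) {{fromℕ-nonNeg m}}
  ℕ-rearrange : ∀ c m n → c ℕ.* 3 ℕ.* m ℕ.+ m ℕ.* (2 ℕ.* n) ≡ 3 ℕ.* m ℕ.* c ℕ.+ 2 ℕ.* n ℕ.* m
  ℕ-rearrange = ℕ-solve-∀
  ℚ-rearrange : ∀ x y e m n z → x * m * ((y + e) * n) + z * n * m ≡ (x * y + z + x * e) * m * n
  ℚ-rearrange = ℚ-solve-∀ ℚ-ring

lemma9 : (n m : ℕ) (G : SimpleGraph n m) (ε : ℚ) → 0ℚ < ε →
  (σ : Fin n → List (Fin m)) → (∀ i → σ i ↭ filter (incident? G i) (allFin m)) →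
  (τ : List (Fin n × Fin m)) → τ ↭ cartesianProduct (allFin n) (allFin m) →
  (∃ λ (C : Subset n) → IsMinVertexCover G C ×
      ((+ ∣ C ∣) / 1 ≤ ((+ 2) / 3 + ε) * ((+ n) / 1))) →
  ∃ λ (M : Matching (H G σ τ)) → Stable (H G σ τ) M × APerfect (H G σ τ) M ×
      ((+ totalCost (H G σ τ) M) / 1 ≤ ((+ 4) / 1 + (+ 3) / 1 * ε) * ((+ m) / 1) * ((+ n) / 1))
lemma9 n m G ε _ σ σ-incident τ τ-all (C , (C-cover , _) , C-small) =
  M , match-stable , match-perfect ,
  subst (_≤ ((+ 4) / 1 + (+ 3) / 1 * ε) * fromℕ m * fromℕ n) (cong fromℕ (sym match-totalCost))
        (cost-bound m n ∣ C ∣ ε C-small)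
  where open Construction G σ σ-incident τ τ-all
        open CoverMatching C C-cover
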